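{- For every $n\ge1$ there exist two full skew trees $T_1$ and $T_2$, each with $n$ internal nodes, whose skew rotation distance is at least $\frac{n(n-1)}{2}$.
   Context: A full binary tree is a rooted ordered tree whose nodes are leaves or internal nodes with exactly two children; a full skew tree is one in which every internal node has at least one leaf child. A right rotation at an internal node $a$ whose left child $b$ is internal, with $C,D$ the subtrees of $b$ and $E$ the right subtree of $a$, replaces the subtree at $a$ by the tree with root $b$, left subtree $C$, right child $a$ having subtrees $D,E$; a left rotation is its inverse. The skew rotation distance between two full skew trees with the same number of internal nodes is the minimum number of rotations transforming one into the other such that every intermediate tree is also a full skew tree. -}

module Defs where

open import Data.Nat using (ℕ; zero; suc; _+_; _≤_)

data Tree : Set where
  leaf : Tree
  node : Tree → Tree → Tree

internals : Tree → ℕ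
internals leaf       = 0
internals (node l r) = suc (internals l + internals r)

data Skew : Tree → Set where
  skew-leaf  : Skew leaf
  skew-nodeˡ : ∀ {r} → Skew r → Skew (node leaf r)
  skew-nodeʳ : ∀ {l} → Skew l → Skew (node l leaf)

data RightRot : Tree → Tree → Set where
  here   : ∀ C D E → RightRot (node (node C D) E) (node C (node D E))
  inLeft : ∀ {l l′} r → RightRot l l′ → RightRot (node l r) (node l′ r)
  inRight : ∀ l {r r′} → RightRot r r′ → RightRot (node l r) (node l r′)

data Rot (S T : Tree) : Set where
  right : RightRot S T → Rot S T
  left  : RightRot T S → Rot S T

data SkewPath : ℕ → Tree → Tree → Set where
  stop : ∀ {T} → Skew T → SkewPath 0 T T
  step : ∀ {k S U T} → Skew S → Rot S U → SkewPath k U T → SkewPath (suc k) S T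

SkewDistAtLeast : Tree → Tree → ℕ → Set
SkewDistAtLeast S T d = ∀ k → SkewPath k S T → d ≤ k

-- The potential "sum over internal nodes of the number of internal nodes in the left
-- subtree" drops by exactly one under a right rotation between full skew trees and rises
-- by exactly one under a left rotation.  It is n(n-1)/2 on the left comb and 0 on the
-- right comb, so every skew rotation sequence between them has length at least n(n-1)/2.
module Submission where

open import Defs
open import Data.Nat using (ℕ; zero; suc; _+_; _≤_; _*_; _∸_; _/_)
open import Data.Nat.Properties using (module ≤-Reasoning; +-suc; +-identityʳ; ≤-refl; ≤-trans; ≤-reflexive; n≤1+n; +-monoʳ-≤)
open import Data.Nat.DivMod using (m*n/n≡m)
open import Data.Nat.Tactic.RingSolver using (solve-∀)
open import Data.Product using (Σ; _×_; _,_)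
open import Relation.Binary.PropositionalEquality using (_≡_; refl; sym; trans; cong; subst; module ≡-Reasoning)

leftWeight : Tree → ℕ
leftWeight leaf       = 0
leftWeight (node l r) = internals l + leftWeight l + leftWeight r

internals-rightRot : ∀ {S T} → RightRot S T → internals S ≡ internals T
internals-rightRot (here C D E)   = cong suc (reassoc (internals C) (internals D) (internals E))
  where
  reassoc : ∀ c d e → suc (c + d) + e ≡ c + suc (d + e)
  reassoc = solve-∀
internals-rightRot (inLeft r rr)  = cong (λ i → suc (i + internals r)) (internals-rightRot rr)
internals-rightRot (inRight l rr) = cong (λ i → suc (internals l + i)) (internals-rightRot rr)

-- A right rotation of node (node C D) E lowers leftWeight by 1 + internals C,
-- and skewness of the rotated tree forces C = leaf.
leftWeight-rightRot-skew : ∀ {S T} → RightRot S T → Skew S → Skew T →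
                           leftWeight S ≡ suc (leftWeight T)
leftWeight-rightRot-skew (here .leaf D .leaf) (skew-nodeʳ _) (skew-nodeˡ _) = refl
leftWeight-rightRot-skew (inLeft {l′ = l′} .leaf rr) (skew-nodeʳ s) (skew-nodeʳ t)
  rewrite internals-rightRot rr | leftWeight-rightRot-skew rr s t =
  cong (_+ 0) (+-suc (internals l′) (leftWeight l′))
leftWeight-rightRot-skew (inRight .leaf rr) (skew-nodeˡ s) (skew-nodeˡ t) =
  leftWeight-rightRot-skew rr s t

leftWeight-rot-skew : ∀ {S T} → Rot S T → Skew S → Skew T → leftWeight S ≤ suc (leftWeight T)
leftWeight-rot-skew (right rr) s t = ≤-reflexive (leftWeight-rightRot-skew rr s t)
leftWeight-rot-skew (left rr)  s t rewrite leftWeight-rightRot-skew rr t s =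
  ≤-trans (n≤1+n _) (n≤1+n _)

skewPath-source : ∀ {k S T} → SkewPath k S T → Skew S
skewPath-source (stop s)     = s
skewPath-source (step s _ _) = s

leftWeight-skewPath : ∀ {k S T} → SkewPath k S T → leftWeight S ≤ k + leftWeight T
leftWeight-skewPath (stop _)       = ≤-refl
leftWeight-skewPath (step s rot p) =
  ≤-trans (leftWeight-rot-skew rot s (skewPath-source p)) (+-monoʳ-≤ 1 (leftWeight-skewPath p))

leftComb : ℕ → Tree
leftComb zero    = leaf
leftComb (suc n) = node (leftComb n) leaf

rightComb : ℕ → Tree
rightComb zero    = leaf
rightComb (suc n) = node leaf (rightComb n)

skew-leftComb : ∀ n → Skew (leftComb n)
skew-leftComb zero    = skew-leaf
skew-leftComb (suc n) = skew-nodeʳ (skew-leftComb n)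

skew-rightComb : ∀ n → Skew (rightComb n)
skew-rightComb zero    = skew-leaf
skew-rightComb (suc n) = skew-nodeˡ (skew-rightComb n)

internals-leftComb : ∀ n → internals (leftComb n) ≡ n
internals-leftComb zero    = refl
internals-leftComb (suc n) = cong suc (trans (+-identityʳ _) (internals-leftComb n))

internals-rightComb : ∀ n → internals (rightComb n) ≡ n
internals-rightComb zero    = refl
internals-rightComb (suc n) = cong suc (internals-rightComb n)

leftWeight-rightComb : ∀ n → leftWeight (rightComb n) ≡ 0
leftWeight-rightComb zero    = refl
leftWeight-rightComb (suc n) = leftWeight-rightComb n

leftWeight-leftComb : ∀ n → leftWeight (leftComb n) * 2 ≡ n * (n ∸ 1)
leftWeight-leftComb zero          = refl
leftWeight-leftComb (suc zero)    = refl
leftWeight-leftComb (suc (suc n)) = begin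
  (internals (leftComb (suc n)) + w + 0) * 2
    ≡⟨ cong (λ i → (i + w + 0) * 2) (internals-leftComb (suc n)) ⟩
  (suc n + w + 0) * 2
    ≡⟨ distrib (suc n) w ⟩
  suc n * 2 + w * 2
    ≡⟨ cong (suc n * 2 +_) (leftWeight-leftComb (suc n)) ⟩
  suc n * 2 + suc n * n
    ≡⟨ triangle n ⟩
  suc (suc n) * suc n ∎
  where
  open ≡-Reasoning
  w : ℕ
  w = leftWeight (leftComb (suc n))
  distrib : ∀ m v → (m + v + 0) * 2 ≡ m * 2 + v * 2
  distrib = solve-∀
  triangle : ∀ m → suc m * 2 + suc m * m ≡ suc (suc m) * suc m
  triangle = solve-∀

proposition4 : (n : ℕ) → 1 ≤ n →
    Σ Tree λ T₁ → Σ Tree λ T₂ →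
      Skew T₁ × Skew T₂ × internals T₁ ≡ n × internals T₂ ≡ n ×
      SkewDistAtLeast T₁ T₂ (n * (n ∸ 1) / 2)
proposition4 n _ =
  leftComb n , rightComb n , skew-leftComb n , skew-rightComb n ,
  internals-leftComb n , internals-rightComb n , distance
  where
  weight≡bound : leftWeight (leftComb n) ≡ n * (n ∸ 1) / 2
  weight≡bound = subst (λ m → leftWeight (leftComb n) ≡ m / 2) (leftWeight-leftComb n)
                       (sym (m*n/n≡m (leftWeight (leftComb n)) 2))
  distance : SkewDistAtLeast (leftComb n) (rightComb n) (n * (n ∸ 1) / 2)
  distance k p = subst (_≤ k) weight≡bound (begin
    leftWeight (leftComb n)       ≤⟨ leftWeight-skewPath p ⟩
    k + leftWeight (rightComb n)  ≡⟨ cong (k +_) (leftWeight-rightComb n) ⟩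
    k + 0                         ≡⟨ +-identityʳ k ⟩
    k                             ∎)
    where open ≤-Reasoning
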